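{- Let $S$ be a set of finite strings, no one a substring of another, and let $c$ be a small cycle of $\mathcal{C}(S)$, i.e. $o(c)>2w(c)$. Then every string of $c$ is equivalent to $R_c$ (hence all strings of $c$ are pairwise equivalent), and in particular $\mathrm{period}(s)=w(c)$ for every string $s$ of $c$.
   Context: For strings $s\neq t$, $\mathrm{ov}(s,t)$ is the longest suffix of $s$ that is a prefix of $t$; $\mathrm{ov}(s,s)$ is the longest suffix of $s$ of length less than $|s|$ that is also a prefix of $s$. Write $s=\mathrm{pref}(s,t)\mathrm{ov}(s,t)$, $\mathrm{dist}(s,t)=|\mathrm{pref}(s,t)|$, and $\mathrm{period}(s)=|\mathrm{pref}(s,s)|$. $\mathcal{C}(S)$ is the cycle cover computed by MGREEDY (fixed tie-breaking): sort all ordered pairs $(s,t)$ of $S$ (including $s=t$) by non-increasing $|\mathrm{ov}(s,t)|$, scan and add $(s,t)$ iff no previously added edge has tail $s$ or head $t$; it is a minimum-length cycle cover of the complete directed graph with self-loops on $S$ with lengths $\mathrm{dist}$. For a cycle $c=s_{c_0}\to\dots\to s_{c_{r-1}}\to s_{c_0}$ whose cycle-closing edge (last edge added by MGREEDY) is $(s_{c_{r-1}},s_{c_0})$: $w(c)$ is the sum of $\mathrm{dist}$ over its edges, $o(c)=|\mathrm{ov}(s_{c_{r-1}},s_{c_0})|$, and $R_c=\mathrm{pref}(s_{c_0},s_{c_1})\cdots\mathrm{pref}(s_{c_{r-2}},s_{c_{r-1}})s_{c_{r-1}}$. Strings $s,t$ are equivalent if $\mathrm{pref}(t,t)$ is a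 rotation of $\mathrm{pref}(s,s)$. -}

module Defs where

open import Data.Nat using (ℕ; zero; suc; _+_; _*_; _∸_; _≤_; _<_; _⊔_; _⊓_)
open import Data.Bool using (Bool; true; false; if_then_else_; _∨_)
open import Data.List using (List; []; _∷_; _++_; length; take; drop; foldl; concat; tabulate; concatMap; map; lookup)
open import Data.List.Properties using (≡-dec)
open import Data.Bool.ListAction using (any)
open import Data.Nat.ListAction using (sum)
open import Data.List.Membership.Propositional using (_∈_)
open import Data.List.Relation.Unary.AllPairs using (AllPairs)
open import Data.List.Relation.Unary.Unique.Propositional using (Unique)
open import Data.Fin using (Fin; toℕ; inject₁; fromℕ) renaming (zero to fzero; suc to fsuc)
open import Data.Fin.Properties using () renaming (_≟_ to _≟F_)
open import Data.Product using (Σ; ∃; ∃-syntax; _×_; _,_; proj₁; proj₂)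
open import Relation.Nullary using (¬_; does)
open import Relation.Binary.PropositionalEquality using (_≡_; _≢_)
open import Relation.Binary.Definitions using (DecidableEquality)

module Strings {A : Set} (_≟_ : DecidableEquality A) where

  _≟L_ : DecidableEquality (List A)
  _≟L_ = ≡-dec _≟_

  -- largest k ≤ b with p k true (p 0 is assumed true / 0 is the default)
  largest : (ℕ → Bool) → ℕ → ℕ
  largest p zero = zero
  largest p (suc k) = if p (suc k) then suc k else largest p k

  suffPref : List A → List A → ℕ → Bool
  suffPref s t k = does (drop (length s ∸ k) s ≟L take k t)

  -- |ov(s,t)|: for s ≠ t the longest suffix of s that is a prefix of t;
  -- for s = t the longest such with length < |s|.
  ovLen : List A → List A → ℕ
  ovLen s t = largest (suffPref s t)
                (if does (s ≟L t) then length s ∸ 1 else length s ⊓ length t)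

  ov : List A → List A → List A
  ov s t = drop (length s ∸ ovLen s t) s

  pref : List A → List A → List A
  pref s t = take (length s ∸ ovLen s t) s

  dist : List A → List A → ℕ
  dist s t = length (pref s t)

  period : List A → ℕ
  period s = dist s s

  IsRotation : List A → List A → Set
  IsRotation x y = ∃[ u ] ∃[ v ] (x ≡ u ++ v × y ≡ v ++ u)

  Equivalent : List A → List A → Set
  Equivalent s t = IsRotation (pref s s) (pref t t)

  Substring : List A → List A → Set
  Substring s t = ∃[ u ] ∃[ v ] (t ≡ u ++ s ++ v)

  module Instance {n : ℕ} (S : Fin n → List A) where

    Edge : Set
    Edge = Fin n × Fin n

    ovE : Edge → ℕ
    ovE (i , j) = ovLen (S i) (S j)

    allPairs : List Edge
    allPairs = concatMap (λ i → map (λ j → (i , j)) (tabulate (λ j → j))) (tabulate (λ i → i))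

    -- an admissible scanning order of MGREEDY: every ordered pair exactly once,
    -- sorted by non-increasing overlap length (ties broken arbitrarily but fixed)
    record ValidOrder (ord : List Edge) : Set where
      field
        complete : ∀ e → e ∈ ord
        unique   : Unique ord
        sorted   : AllPairs (λ e f → ovE f ≤ ovE e) ord

    step : List Edge → Edge → List Edge
    step acc (i , j) =
      if any (λ e → does (proj₁ e ≟F i) ∨ does (proj₂ e ≟F j)) acc
      then acc else acc ++ ((i , j) ∷ [])

    -- the edges of C(S), listed in the order MGREEDY adds them
    mgreedy : List Edge → List Edge
    mgreedy ord = foldl step [] ord

    AddedNoLaterThan : List Edge → Edge → Edge → Set
    AddedNoLaterThan G e f =
      ∃[ q ] ∃[ p ] (lookup G q ≡ e × lookup G p ≡ f × toℕ q ≤ toℕ p)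

    -- A cycle c = s_{c_0} → … → s_{c_m} → s_{c_0} (r = m+1) given by c : Fin (suc m) → Fin n.
    module Cycle {m : ℕ} (c : Fin (suc m) → Fin n) where

      edge : Fin m → Edge
      edge k = (c (inject₁ k) , c (fsuc k))

      closing : Edge
      closing = (c (fromℕ m) , c fzero)

      -- c is a cycle of the cycle cover G whose cycle-closing (last added) edge is `closing`
      record IsCycleOf (G : List Edge) : Set where
        field
          injective   : ∀ k l → c k ≡ c l → k ≡ l
          edges∈      : ∀ k → edge k ∈ G
          closing∈    : closing ∈ G
          closingLast : ∀ k → AddedNoLaterThan G (edge k) closing

      w : ℕ
      w = sum (tabulate (λ k → dist (S (proj₁ (edge k))) (S (proj₂ (edge k)))))
          + dist (S (c (fromℕ m))) (S (c fzero))

      o : ℕ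
      o = ovLen (S (c (fromℕ m))) (S (c fzero))

      R : List A
      R = concat (tabulate (λ k → pref (S (proj₁ (edge k))) (S (proj₂ (edge k)))))
          ++ S (c (fromℕ m))

-- Let s_0 → ⋯ → s_m → s_0 be the small cycle, d_i = dist(s_i, s_{i+1}) and
-- P_i = d_0 + ⋯ + d_{i-1}, so that s_i occurs in R_c at position P_i and w = P_{m+1}.
-- The closing overlap ov(s_m, s_0) occurs in R_c both at w and at 0 and reaches the end of
-- R_c, so R_c has period w, and so has every s_i as a factor of R_c.
-- No shorter period p is possible: if P_k ≤ p < P_{k+1}, then s_0 continues s_k from
-- position p - P_k < d_k on, so ov(s_k, s_0) > ov(s_k, s_{k+1}); but MGREEDY rejected the
-- edge (s_k, s_0) only for an adjacent edge of at least its overlap, namely the cycle edge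
-- out of s_k or the closing edge, whose overlap o is the least on the cycle.
-- Substring-freeness rules out the degenerate positions. A period p < w of some s_i would
-- spread to all of R_c, as |s_i| > 2w ≥ p + w. Hence w is the least period of R_c and of
-- every s_i, and the length-w prefix of s_i, read off R_c at position P_i ≤ w, is a
-- rotation of that of R_c.

{-# OPTIONS --safe #-}
module Submission where

open import Defs
open import Algebra.Properties.CommutativeSemigroup using (x∙yz≈y∙xz)
open import Data.Bool using (Bool; true; false; if_then_else_; _∨_)
open import Data.Bool.ListAction using (any)
open import Data.Empty using (⊥-elim)
open import Data.Fin using (Fin; toℕ; inject₁; fromℕ; fromℕ<) renaming (zero to fzero; suc to fsuc)
open import Data.Fin.Properties using (toℕ-injective; toℕ<n; toℕ-fromℕ; toℕ-fromℕ<; toℕ-inject₁) renaming (_≟_ to _≟F_)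
open import Data.List using (List; []; _∷_; _++_; length; take; drop; foldl; lookup; concat; tabulate)
open import Data.List.Membership.Propositional using (_∈_)
open import Data.List.Membership.Propositional.Properties using (∈-++⁺ˡ; ∈-++⁺ʳ; ∈-lookup)
open import Data.List.Properties using (length-take; length-drop; length-++; ++-assoc; ++-identityʳ; take++drop≡id)
open import Data.List.Relation.Unary.All as All using (All; []; _∷_)
open import Data.List.Relation.Unary.All.Properties as All using ()
open import Data.List.Relation.Unary.AllPairs as AllPairs using (AllPairs; []; _∷_)
open import Data.List.Relation.Unary.AllPairs.Properties as AllPairs using ()
open import Data.List.Relation.Unary.Any using (here; there)
open import Data.Maybe using (Maybe; just; nothing)
open import Data.Nat using (ℕ; zero; suc; _+_; _*_; _∸_; _≤_; _<_; _⊓_; z≤n; s≤s; s≤s⁻¹)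
open import Data.Nat.DivMod using (_mod_; m<n⇒m%n≡m; n%n≡0)
open import Data.Nat.Induction using (<-rec)
open import Data.Nat.ListAction using (sum)
open import Data.Nat.Properties
open import Data.Product using (∃-syntax; _×_; _,_; proj₁; proj₂)
open import Data.Sum using (_⊎_; inj₁; inj₂; [_,_]′)
open import Function using (_∘_)
open import Relation.Binary.Definitions using (DecidableEquality)
open import Relation.Binary.PropositionalEquality
open import Relation.Nullary using (¬_; does; yes; no)

x+[y+z]≡y+[x+z] : ∀ x y z → x + (y + z) ≡ y + (x + z)
x+[y+z]≡y+[x+z] = x∙yz≈y∙xz +-commutativeSemigroup

<∸⇒+< : ∀ g {a m} → a < m ∸ g → g + a < m
<∸⇒+< zero    p = p
<∸⇒+< (suc g) {m = suc m} p = s≤s (<∸⇒+< g p)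

+<⇒<∸ : ∀ g {a m} → g + a < m → a < m ∸ g
+<⇒<∸ zero    p = p
+<⇒<∸ (suc g) {m = suc m} (s≤s p) = +<⇒<∸ g p

module _ {A : Set} where

  -- Indexing with Maybe, so that positions are compared without carrying bound proofs.
  at : List A → ℕ → Maybe A
  at []       _       = nothing
  at (x ∷ xs) zero    = just x
  at (x ∷ xs) (suc a) = at xs a

  at-++ˡ : ∀ xs ys {a} → a < length xs → at (xs ++ ys) a ≡ at xs a
  at-++ˡ (x ∷ xs) ys {zero}  _       = refl
  at-++ˡ (x ∷ xs) ys {suc a} (s≤s p) = at-++ˡ xs ys p

  at-++ʳ : ∀ xs ys a → at (xs ++ ys) (length xs + a) ≡ at ys a
  at-++ʳ []       ys a = refl
  at-++ʳ (x ∷ xs) ys a = at-++ʳ xs ys a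

  at-take : ∀ k xs {a} → a < k → at (take k xs) a ≡ at xs a
  at-take (suc k) []       _       = refl
  at-take (suc k) (x ∷ xs) {zero}  _       = refl
  at-take (suc k) (x ∷ xs) {suc a} (s≤s p) = at-take k xs p

  at-drop : ∀ k xs a → at (drop k xs) a ≡ at xs (k + a)
  at-drop zero    xs       a = refl
  at-drop (suc k) []       a = refl
  at-drop (suc k) (x ∷ xs) a = at-drop k xs a

  at-<-length : ∀ xs {a} → a < length xs → ∃[ v ] at xs a ≡ just v
  at-<-length (x ∷ xs) {zero}  _       = x , refl
  at-<-length (x ∷ xs) {suc a} (s≤s p) = at-<-length xs p

  at-ext : ∀ xs ys → length xs ≡ length ys → (∀ a → a < length xs → at xs a ≡ at ys a) → xs ≡ ys
  at-ext []       []       _ _ = refl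
  at-ext (x ∷ xs) (y ∷ ys) l h with h 0 (s≤s z≤n)
  ... | refl = cong (x ∷_) (at-ext xs ys (suc-injective l) (λ a p → h (suc a) (s≤s p)))

  length-take≤ : ∀ k (xs : List A) → k ≤ length xs → length (take k xs) ≡ k
  length-take≤ k xs p = trans (length-take k xs) (m≤n⇒m⊓n≡m p)

  at-just⇒< : ∀ xs {a v} → at xs a ≡ just v → a < length xs
  at-just⇒< (x ∷ xs) {zero}  _ = s≤s z≤n
  at-just⇒< (x ∷ xs) {suc a} p = s≤s (at-just⇒< xs p)

module _ {A : Set} where

  record OccursAt (x : List A) (b : ℕ) (y : List A) : Set where
    constructor mkOccursAt
    field letters : ∀ a → a < length x → at y (b + a) ≡ at x a

  record IsPeriod (x : List A) (p : ℕ) : Set where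
    constructor mkIsPeriod
    field repeats : ∀ a → p + a < length x → at x (p + a) ≡ at x a

  open OccursAt public
  open IsPeriod public

  occursAt-< : ∀ {x b y a} → OccursAt x b y → a < length x → b + a < length y
  occursAt-< {x} {y = y} occ a< with at-<-length x a<
  ... | _ , eq = at-just⇒< y (trans (letters occ _ a<) eq)

  occursAt-≤ : ∀ {x b y k} → OccursAt x b y → 0 < k → k ≤ length x → b + k ≤ length y
  occursAt-≤ {b = b} {y} {suc k} occ _ k< = subst (_≤ length y) (sym (+-suc b k)) (occursAt-< occ k<)

  occursAt-refl : ∀ x → OccursAt x 0 x
  occursAt-refl x = mkOccursAt λ _ _ → refl

  occursAt-trans : ∀ {x b y c z} → OccursAt x b y → OccursAt y c z → OccursAt x (c + b) z
  occursAt-trans {x} {b} {y} {c} {z} occ₁ occ₂ = mkOccursAt λ a a< → begin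
      at z (c + b + a)    ≡⟨ cong (at z) (+-assoc c b a) ⟩
      at z (c + (b + a))  ≡⟨ letters occ₂ (b + a) (occursAt-< occ₁ a<) ⟩
      at y (b + a)        ≡⟨ letters occ₁ a a< ⟩
      at x a              ∎
    where open ≡-Reasoning

  occursAt-take : ∀ k y → OccursAt (take k y) 0 y
  occursAt-take k y = mkOccursAt λ a a< →
    sym (at-take k y (≤-trans a< (≤-trans (≤-reflexive (length-take k y)) (m⊓n≤m k (length y)))))

  occursAt-++ʳ : ∀ xs ys → OccursAt ys (length xs) (xs ++ ys)
  occursAt-++ʳ xs ys = mkOccursAt λ a _ → at-++ʳ xs ys a

  occursAt-++-prefix : ∀ u {v w} → OccursAt v 0 w → OccursAt (u ++ v) 0 (u ++ w)
  occursAt-++-prefix []      occ = occ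
  occursAt-++-prefix (_ ∷ u) occ = mkOccursAt λ where
    zero    _        → refl
    (suc a) (s≤s a<) → letters (occursAt-++-prefix u occ) a a<

  occursAt-drop : ∀ k x → OccursAt (drop k x) k x
  occursAt-drop k x = mkOccursAt λ a _ → sym (at-drop k x a)

  occursAt-twice⇒isPeriod : ∀ {z w y} → OccursAt z w y → OccursAt z 0 y → length y ≤ w + length z →
                            IsPeriod y w
  occursAt-twice⇒isPeriod {z} {w} {y} occ-w occ-0 y≤ = mkIsPeriod λ a wa< →
    let a<z = +-cancelˡ-< w a (length z) (<-≤-trans wa< y≤)
    in trans (letters occ-w a a<z) (sym (letters occ-0 a a<z))

  occursAt-0⇒≤ : ∀ {x y} → OccursAt x 0 y → length x ≤ length y
  occursAt-0⇒≤ {[]}    _   = z≤n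
  occursAt-0⇒≤ {_ ∷ _} occ = occursAt-≤ occ (s≤s z≤n) ≤-refl

  occursAt-0⇒take : ∀ {x y} → OccursAt x 0 y → x ≡ take (length x) y
  occursAt-0⇒take {x} {y} occ =
    at-ext x (take (length x) y) (sym (length-take≤ (length x) y (occursAt-0⇒≤ occ)))
      (λ a a< → trans (sym (letters occ a a<)) (sym (at-take (length x) y a<)))

  occursAt⇒infix : ∀ {x b y} → OccursAt x b y → ∃[ u ] ∃[ v ] (y ≡ u ++ x ++ v)
  occursAt⇒infix {x} {b} {y} occ = take b y , rest , (begin
      y                                                ≡⟨ take++drop≡id b y ⟨
      take b y ++ drop b y                             ≡⟨ cong (take b y ++_) (take++drop≡id (length x) (drop b y)) ⟨
      take b y ++ take (length x) (drop b y) ++ rest   ≡⟨ cong (λ z → take b y ++ z ++ rest) x≡ ⟨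
      take b y ++ x ++ rest                            ∎)
    where
    open ≡-Reasoning
    rest : List A
    rest = drop (length x) (drop b y)
    x≡ : x ≡ take (length x) (drop b y)
    x≡ = occursAt-0⇒take (mkOccursAt λ a a< → trans (at-drop b y a) (letters occ a a<))

  isPeriod⇒occursAt-drop : ∀ {x g} → IsPeriod x g → OccursAt (drop g x) 0 x
  isPeriod⇒occursAt-drop {x} {g} per = mkOccursAt λ a a< →
    sym (trans (at-drop g x a) (repeats per a (<∸⇒+< g (subst (a <_) (length-drop g x) a<))))

  occursAt-drop⇒isPeriod : ∀ {x g} → OccursAt (drop g x) 0 x → IsPeriod x g
  occursAt-drop⇒isPeriod {x} {g} occ = mkIsPeriod λ a ga< →
    trans (sym (at-drop g x a)) (sym (letters occ a (subst (a <_) (sym (length-drop g x)) (+<⇒<∸ g ga<))))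

  isPeriod-occursAt : ∀ {x b y p} → IsPeriod y p → OccursAt x b y → IsPeriod x p
  isPeriod-occursAt {x} {b} {y} {p} per occ = mkIsPeriod λ a pa< → begin
      at x (p + a)        ≡⟨ letters occ (p + a) pa< ⟨
      at y (b + (p + a))  ≡⟨ cong (at y) (x+[y+z]≡y+[x+z] b p a) ⟩
      at y (p + (b + a))  ≡⟨ repeats per (b + a) (subst (_< length y) (x+[y+z]≡y+[x+z] b p a) (occursAt-< occ pa<)) ⟩
      at y (b + a)        ≡⟨ letters occ a (≤-<-trans (m≤n+m a p) pa<) ⟩
      at x a              ∎
    where open ≡-Reasoning

  isPeriod⇒continues : ∀ {x b y z g p} → IsPeriod y p → OccursAt x b y → OccursAt z 0 y → b + g ≡ p →
                       ∀ a → g + a < length x → a < length z → at x (g + a) ≡ at z a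
  isPeriod⇒continues {x} {b} {y} {z} {g} {p} per occX occZ b+g≡p a ga< a<z = begin
      at x (g + a)        ≡⟨ letters occX (g + a) ga< ⟨
      at y (b + (g + a))  ≡⟨ cong (at y) shift ⟩
      at y (p + a)        ≡⟨ repeats per a (subst (_< length y) shift (occursAt-< occX ga<)) ⟩
      at y a              ≡⟨ letters occZ a a<z ⟩
      at z a              ∎
    where
    open ≡-Reasoning
    shift : b + (g + a) ≡ p + a
    shift = trans (sym (+-assoc b g a)) (cong (_+ a) b+g≡p)

  continues⇒occursAt : ∀ x g z → (∀ a → g + a < length x → a < length z → at x (g + a) ≡ at z a) →
                       OccursAt (drop g x) 0 z ⊎ OccursAt z g x
  continues⇒occursAt x g z continues with length x ∸ g ≤? length z
  ... | yes fits = inj₁ (mkOccursAt λ a a< →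
          let a<x∸g = subst (a <_) (length-drop g x) a<
          in trans (sym (continues a (<∸⇒+< g a<x∸g) (<-≤-trans a<x∸g fits))) (sym (at-drop g x a)))
  ... | no overhang = inj₂ (mkOccursAt λ a a< → continues a (<∸⇒+< g (<-trans a< (≰⇒> overhang))) a<)

  -- The window of y where x sits has period p and is at least p + w long;
  -- the period w of y carries every other position into that window.
  isPeriod-spread : ∀ {x b y p w} → IsPeriod y w → OccursAt x b y → b ≤ w → p < w →
                    p + w ≤ length x → IsPeriod x p → IsPeriod y p
  isPeriod-spread {x} {b} {y} {p} {w} perY occ b≤w p<w p+w≤x perX = mkIsPeriod (λ a → <-rec Goal go a)
    where
    open ≡-Reasoning
    Goal : ℕ → Set
    Goal a = p + a < length y → at y (p + a) ≡ at y a

    0<w : 0 < w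
    0<w = ≤-<-trans z≤n p<w

    inside : ∀ {i} → i < b + (p + w) → i < length y
    inside i< = <-≤-trans i< (occursAt-≤ occ (<-≤-trans 0<w (m≤n+m w p)) p+w≤x)

    window : ∀ e → e < w → at y (p + (b + e)) ≡ at y (b + e)
    window e e<w = begin
        at y (p + (b + e))  ≡⟨ cong (at y) (x+[y+z]≡y+[x+z] p b e) ⟩
        at y (b + (p + e))  ≡⟨ letters occ (p + e) pe<x ⟩
        at x (p + e)        ≡⟨ repeats perX e pe<x ⟩
        at x e              ≡⟨ letters occ e (≤-<-trans (m≤n+m e p) pe<x) ⟨
        at y (b + e)        ∎
      where
      pe<x : p + e < length x
      pe<x = <-≤-trans (+-monoʳ-< p e<w) p+w≤x

    go : ∀ a → (∀ {a′} → a′ < a → Goal a′) → Goal a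
    go a rec pa<y with a <? b | a <? b + w
    ... | yes a<b | _ = begin
        at y (p + a)        ≡⟨ repeats perY (p + a) (inside wpa<) ⟨
        at y (w + (p + a))  ≡⟨ cong (at y) (x+[y+z]≡y+[x+z] w p a) ⟩
        at y (p + (w + a))  ≡⟨ cong (λ i → at y (p + i)) e≡ ⟨
        at y (p + (b + e))  ≡⟨ window e e<w ⟩
        at y (b + e)        ≡⟨ cong (at y) e≡ ⟩
        at y (w + a)        ≡⟨ repeats perY a (inside (≤-<-trans (+-monoʳ-≤ w (m≤n+m a p)) wpa<)) ⟩
        at y a              ∎
      where
      e : ℕ
      e = w + a ∸ b
      e≡ : b + e ≡ w + a
      e≡ = m+[n∸m]≡n (≤-trans b≤w (m≤m+n w a))
      e<w : e < w
      e<w = +-cancelˡ-< b e w (subst (_< b + w) (sym e≡)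
              (subst (w + a <_) (+-comm w b) (+-monoʳ-< w a<b)))
      wpa< : w + (p + a) < b + (p + w)
      wpa< = subst (w + (p + a) <_)
               (trans (x+[y+z]≡y+[x+z] w p b) (trans (cong (p +_) (+-comm w b)) (x+[y+z]≡y+[x+z] p b w)))
               (+-monoʳ-< w (+-monoʳ-< p a<b))
    ... | no a≮b | yes a<b+w = begin
        at y (p + a)        ≡⟨ cong (λ i → at y (p + i)) e≡ ⟨
        at y (p + (b + e))  ≡⟨ window e (+-cancelˡ-< b e w (subst (_< b + w) (sym e≡) a<b+w)) ⟩
        at y (b + e)        ≡⟨ cong (at y) e≡ ⟩
        at y a              ∎
      where
      e : ℕ
      e = a ∸ b
      e≡ : b + e ≡ a
      e≡ = m+[n∸m]≡n (≮⇒≥ a≮b)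
    ... | no _ | no a≮b+w = begin
        at y (p + a)         ≡⟨ cong (λ i → at y (p + i)) a′≡ ⟨
        at y (p + (w + a′))  ≡⟨ cong (at y) (x+[y+z]≡y+[x+z] p w a′) ⟩
        at y (w + (p + a′))  ≡⟨ repeats perY (p + a′) (subst (_< length y) (trans (cong (p +_) (sym a′≡))
                                                    (x+[y+z]≡y+[x+z] p w a′)) pa<y) ⟩
        at y (p + a′)        ≡⟨ rec a′<a (≤-<-trans (+-monoʳ-≤ p (m≤n+m a′ w)) (subst (λ i → p + i < length y) (sym a′≡) pa<y)) ⟩
        at y a′              ≡⟨ repeats perY a′ (subst (_< length y) (sym a′≡) (≤-<-trans (m≤n+m a p) pa<y)) ⟨
        at y (w + a′)        ≡⟨ cong (at y) a′≡ ⟩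
        at y a               ∎
      where
      a′ : ℕ
      a′ = a ∸ w
      a′≡ : w + a′ ≡ a
      a′≡ = m+[n∸m]≡n (≤-trans (m≤n+m w b) (≮⇒≥ a≮b+w))
      a′<a : a′ < a
      a′<a = subst (a′ <_) a′≡ (m<n+m a′ 0<w)

  take-isPeriod-rotation : ∀ {x b y w} → IsPeriod y w → OccursAt x b y → b ≤ w → w ≤ length x →
                           take w x ≡ drop b (take w y) ++ take b (take w y)
  take-isPeriod-rotation {w = zero} _ _ z≤n _ = refl
  take-isPeriod-rotation {x} {b} {y} {w@(suc _)} perY occ b≤w w≤x =
    at-ext (take w x) (drop b u ++ take b u) (trans |take-w-x| (sym |rhs|)) pointwise
    where
    open ≡-Reasoning
    b+w≤y : b + w ≤ length y
    b+w≤y = occursAt-≤ occ (s≤s z≤n) w≤x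
    u : List A
    u = take w y
    |u| : length u ≡ w
    |u| = length-take≤ w y (≤-trans (m≤n+m w b) b+w≤y)
    |drop-b-u| : length (drop b u) ≡ w ∸ b
    |drop-b-u| = trans (length-drop b u) (cong (_∸ b) |u|)
    |take-w-x| : length (take w x) ≡ w
    |take-w-x| = length-take≤ w x w≤x
    |rhs| : length (drop b u ++ take b u) ≡ w
    |rhs| = trans (length-++ (drop b u))
              (trans (cong₂ _+_ |drop-b-u| (length-take≤ b u (subst (b ≤_) (sym |u|) b≤w)))
                     (m∸n+n≡m b≤w))
    pointwise : ∀ a → a < length (take w x) → at (take w x) a ≡ at (drop b u ++ take b u) a
    pointwise a a< with a <? w ∸ b
    ... | yes a<w∸b = begin
        at (take w x) a              ≡⟨ at-take w x a<w ⟩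
        at x a                       ≡⟨ letters occ a (<-≤-trans a<w w≤x) ⟨
        at y (b + a)                 ≡⟨ at-take w y (<∸⇒+< b a<w∸b) ⟨
        at u (b + a)                 ≡⟨ at-drop b u a ⟨
        at (drop b u) a              ≡⟨ at-++ˡ (drop b u) (take b u) (subst (a <_) (sym |drop-b-u|) a<w∸b) ⟨
        at (drop b u ++ take b u) a  ∎
      where
      a<w : a < w
      a<w = subst (a <_) |take-w-x| a<
    ... | no a≮w∸b = begin
        at (take w x) a                                    ≡⟨ at-take w x a<w ⟩
        at x a                                             ≡⟨ letters occ a (<-≤-trans a<w w≤x) ⟨
        at y (b + a)                                       ≡⟨ cong (at y) b+a≡ ⟩
        at y (w + a′)                                      ≡⟨ repeats perY a′ (<-≤-trans (+-monoʳ-< w a′<b)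
                                                                 (subst (_≤ length y) (+-comm b w) b+w≤y)) ⟩
        at y a′                                            ≡⟨ at-take w y (<-≤-trans a′<b b≤w) ⟨
        at u a′                                            ≡⟨ at-take b u a′<b ⟨
        at (take b u) a′                                   ≡⟨ at-++ʳ (drop b u) (take b u) a′ ⟨
        at (drop b u ++ take b u) (length (drop b u) + a′) ≡⟨ cong (λ i → at (drop b u ++ take b u) (i + a′)) |drop-b-u| ⟩
        at (drop b u ++ take b u) (w ∸ b + a′)             ≡⟨ cong (at (drop b u ++ take b u)) a≡ ⟩
        at (drop b u ++ take b u) a                        ∎
      where
      a<w : a < w
      a<w = subst (a <_) |take-w-x| a<
      a′ : ℕ
      a′ = a ∸ (w ∸ b)
      a≡ : w ∸ b + a′ ≡ a
      a≡ = m+[n∸m]≡n (≮⇒≥ a≮w∸b)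
      a′<b : a′ < b
      a′<b = +-cancelˡ-< (w ∸ b) a′ b (subst₂ _<_ (sym a≡) (sym (m∸n+n≡m b≤w)) a<w)
      b+a≡ : b + a ≡ w + a′
      b+a≡ = trans (cong (b +_) (sym a≡)) (trans (sym (+-assoc b (w ∸ b) a′)) (cong (_+ a′) (m+[n∸m]≡n b≤w)))

module Overlaps {A : Set} (_≟_ : DecidableEquality A) where
  open Strings _≟_

  ovBound : List A → List A → ℕ
  ovBound s t = if does (s ≟L t) then length s ∸ 1 else length s ⊓ length t

  largest-≤ : ∀ p b → largest p b ≤ b
  largest-≤ p zero = z≤n
  largest-≤ p (suc b) with p (suc b)
  ... | true  = ≤-refl
  ... | false = m≤n⇒m≤1+n (largest-≤ p b)

  largest-holds : ∀ p b → p (largest p b) ≡ true ⊎ largest p b ≡ 0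
  largest-holds p zero = inj₂ refl
  largest-holds p (suc b) with p (suc b) in eq
  ... | true  = inj₁ eq
  ... | false = largest-holds p b

  largest-maximal : ∀ p b k → k ≤ b → p k ≡ true → k ≤ largest p b
  largest-maximal p zero    k k≤b _ = k≤b
  largest-maximal p (suc b) k k≤b pk with p (suc b) in eq | m≤n⇒m<n∨m≡n k≤b
  ... | true  | _         = k≤b
  ... | false | inj₁ k<1+b = largest-maximal p b k (s≤s⁻¹ k<1+b) pk
  ... | false | inj₂ refl  with () ← trans (sym pk) eq

  ovLen-≤ : ∀ s t → ovLen s t ≤ length s
  ovLen-≤ s t = ≤-trans (largest-≤ (suffPref s t) _) bound≤
    where
    bound≤ : ovBound s t ≤ length s
    bound≤ with does (s ≟L t)
    ... | true  = m∸n≤m (length s) 1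
    ... | false = m⊓n≤m (length s) (length t)

  ovLen-self-< : ∀ s → 0 < length s → ovLen s s < length s
  ovLen-self-< s 0<s with s ≟L s
  ... | yes _  = ≤-<-trans (largest-≤ (suffPref s s) (length s ∸ 1)) (∸-monoʳ-< {o = 0} (s≤s z≤n) 0<s)
  ... | no s≢s = ⊥-elim (s≢s refl)

  dist≡ : ∀ s t → dist s t ≡ length s ∸ ovLen s t
  dist≡ s t = length-take≤ (length s ∸ ovLen s t) s (m∸n≤m (length s) (ovLen s t))

  dist+ovLen : ∀ s t → dist s t + ovLen s t ≡ length s
  dist+ovLen s t = trans (cong (_+ ovLen s t) (dist≡ s t)) (m∸n+n≡m (ovLen-≤ s t))

  pref≡take : ∀ s t → pref s t ≡ take (dist s t) s
  pref≡take s t = cong (λ k → take k s) (sym (dist≡ s t))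

  ov≡take : ∀ s t → drop (dist s t) s ≡ take (ovLen s t) t
  ov≡take s t rewrite dist≡ s t with largest-holds (suffPref s t) (ovBound s t)
  ... | inj₁ holds = from-does holds
    where
    from-does : ∀ {k} → suffPref s t k ≡ true → drop (length s ∸ k) s ≡ take k t
    from-does {k} eq with drop (length s ∸ k) s ≟L take k t
    ... | yes p = p
  ... | inj₂ zero≡ rewrite zero≡ = drop-length s
    where
    drop-length : ∀ (xs : List A) → drop (length xs ∸ 0) xs ≡ []
    drop-length []       = refl
    drop-length (x ∷ xs) = drop-length xs

  occursAt-ov : ∀ s t → OccursAt (drop (dist s t) s) 0 t
  occursAt-ov s t rewrite ov≡take s t = occursAt-take (ovLen s t) t

  ovLen-≥ : ∀ s t g → g ≤ length s → (s ≡ t → 0 < g) → OccursAt (drop g s) 0 t →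
            length s ∸ g ≤ ovLen s t
  ovLen-≥ s t g g≤s s≡t⇒0<g occ = largest-maximal (suffPref s t) (ovBound s t) k k≤bound holds
    where
    k : ℕ
    k = length s ∸ g
    |drop| : length (drop g s) ≡ k
    |drop| = length-drop g s
    k≤t : k ≤ length t
    k≤t = subst (_≤ length t) |drop| (occursAt-0⇒≤ occ)
    k≤bound : k ≤ ovBound s t
    k≤bound with s ≟L t
    ... | yes s≡t = ∸-monoʳ-≤ (length s) (s≡t⇒0<g s≡t)
    ... | no _    = ⊓-glb (m∸n≤m (length s) g) k≤t
    holds : suffPref s t k ≡ true
    holds with drop (length s ∸ k) s ≟L take k t
    ... | yes _  = refl
    ... | no ¬eq = ⊥-elim (¬eq (begin
        drop (length s ∸ k) s            ≡⟨ cong (λ i → drop i s) (m∸[m∸n]≡n g≤s) ⟩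
        drop g s                         ≡⟨ occursAt-0⇒take occ ⟩
        take (length (drop g s)) t       ≡⟨ cong (λ i → take i t) |drop| ⟩
        take k t                         ∎))
      where open ≡-Reasoning

  dist-positive : ∀ s t → 0 < length s → (Substring s t → s ≡ t) → 0 < dist s t
  dist-positive s t 0<s sub⇒≡ with dist s t | occursAt-ov s t | dist+ovLen s t
  ... | suc _ | _   | _      = s≤s z≤n
  ... | zero  | occ | ovLen≡ with sub⇒≡ (occursAt⇒infix occ)
  ...   | refl = ⊥-elim (<-irrefl ovLen≡ (ovLen-self-< s 0<s))

  dist-self-isPeriod : ∀ x → IsPeriod x (dist x x)
  dist-self-isPeriod x = occursAt-drop⇒isPeriod (occursAt-ov x x)

  dist-self-≡-least-period : ∀ x w → 0 < w → w ≤ length x → IsPeriod x w →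
                             (∀ p → 0 < p → p < w → ¬ IsPeriod x p) → dist x x ≡ w
  dist-self-≡-least-period x w 0<w w≤x perW noSmaller = ≤-antisym dist≤w w≤dist
    where
    open ≤-Reasoning
    w≤dist : w ≤ dist x x
    w≤dist with w ≤? dist x x
    ... | yes w≤ = w≤
    ... | no w≰ = ⊥-elim (noSmaller (dist x x) (dist-positive x x (<-≤-trans 0<w w≤x) (λ _ → refl))
                                    (≰⇒> w≰) (dist-self-isPeriod x))
    dist≤w : dist x x ≤ w
    dist≤w = begin
      dist x x                     ≡⟨ dist≡ x x ⟩
      length x ∸ ovLen x x         ≤⟨ ∸-monoʳ-≤ (length x) (ovLen-≥ x x w w≤x (λ _ → 0<w)
                                                               (isPeriod⇒occursAt-drop perW)) ⟩
      length x ∸ (length x ∸ w)    ≡⟨ m∸[m∸n]≡n w≤x ⟩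
      w                            ∎

pos : (ℕ → ℕ) → ℕ → ℕ
pos d zero    = 0
pos d (suc i) = d 0 + pos (d ∘ suc) i

pos-suc : ∀ d i → pos d (suc i) ≡ pos d i + d i
pos-suc d zero    = +-comm (d 0) 0
pos-suc d (suc i) = trans (cong (d 0 +_) (pos-suc (d ∘ suc) i)) (sym (+-assoc (d 0) _ (d (suc i))))

pos-mono : ∀ d {i j} → i ≤ j → pos d i ≤ pos d j
pos-mono d {zero}  _         = z≤n
pos-mono d {suc i} (s≤s i≤j) = +-monoʳ-≤ (d 0) (pos-mono (d ∘ suc) i≤j)

pos-locate : ∀ d N {p} → p < pos d N → ∃[ k ] (k < N × pos d k ≤ p × p < pos d (suc k))
pos-locate d zero    ()
pos-locate d (suc N) {p} p< with p <? pos d N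
... | yes p<N = let k , k<N , rest = pos-locate d N p<N in k , m<n⇒m<1+n k<N , rest
... | no p≮N  = N , ≤-refl , ≮⇒≥ p≮N , p<

sum-tabulate≡pos : ∀ d t (f : Fin t → ℕ) → (∀ k → f k ≡ d (toℕ k)) → sum (tabulate f) ≡ pos d t
sum-tabulate≡pos d zero    f f≡ = refl
sum-tabulate≡pos d (suc t) f f≡ = cong₂ _+_ (f≡ fzero) (sum-tabulate≡pos (d ∘ suc) t (f ∘ fsuc) (f≡ ∘ fsuc))

module _ {A : Set} where

  merge : (ℕ → List A) → (ℕ → ℕ) → ℕ → List A
  merge x d zero    = x 0
  merge x d (suc t) = take (d 0) (x 0) ++ merge (x ∘ suc) (d ∘ suc) t

  Chained : (ℕ → List A) → (ℕ → ℕ) → Set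
  Chained x d = ∀ j → d j ≤ length (x j) × OccursAt (drop (d j) (x j)) 0 (x (suc j))

  concat-tabulate≡merge : ∀ x d t (f : Fin t → List A) → (∀ k → f k ≡ take (d (toℕ k)) (x (toℕ k))) →
                          concat (tabulate f) ++ x t ≡ merge x d t
  concat-tabulate≡merge x d zero    f f≡ = refl
  concat-tabulate≡merge x d (suc t) f f≡ =
    trans (++-assoc (f fzero) (concat (tabulate (f ∘ fsuc))) (x (suc t)))
          (cong₂ _++_ (f≡ fzero) (concat-tabulate≡merge (x ∘ suc) (d ∘ suc) t (f ∘ fsuc) (f≡ ∘ fsuc)))

  chained-suc : ∀ {x d} → Chained x d → Chained (x ∘ suc) (d ∘ suc)
  chained-suc chained = chained ∘ suc

  length-merge : ∀ {x d} → Chained x d → ∀ t → length (merge x d t) ≡ pos d t + length (x t)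
  length-merge         chained zero    = refl
  length-merge {x} {d} chained (suc t) = trans (length-++ (take (d 0) (x 0)))
    (trans (cong₂ _+_ (length-take≤ (d 0) (x 0) (proj₁ (chained 0))) (length-merge (chained-suc chained) t))
           (sym (+-assoc (d 0) _ _)))

  merge-occursAt : ∀ {x d} → Chained x d → ∀ t i → i ≤ t → OccursAt (x i) (pos d i) (merge x d t)
  merge-occursAt {x}     chained zero    zero    _         = occursAt-refl (x 0)
  merge-occursAt {x} {d} chained (suc t) zero    _         =
    subst (λ z → OccursAt z 0 (merge x d (suc t))) (take++drop≡id (d 0) (x 0))
      (occursAt-++-prefix (take (d 0) (x 0))
        (occursAt-trans (proj₂ (chained 0)) (merge-occursAt (chained-suc chained) t 0 z≤n)))
  merge-occursAt {x} {d} chained (suc t) (suc i) (s≤s i≤t) =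
    subst (λ b → OccursAt (x (suc i)) b (merge x d (suc t))) (cong (_+ pos (d ∘ suc) i) (length-take≤ (d 0) (x 0) (proj₁ (chained 0))))
      (occursAt-trans (merge-occursAt (chained-suc chained) t i i≤t) (occursAt-++ʳ (take (d 0) (x 0)) _))

module Greedy {A : Set} (_≟_ : DecidableEquality A) {n : ℕ} (S : Fin n → List A) where
  open Strings _≟_
  open Instance S

  _≽_ : Edge → Edge → Set
  e ≽ f = ovE f ≤ ovE e

  Disjoint : Edge → Edge → Set
  Disjoint e f = proj₁ e ≢ proj₁ f × proj₂ e ≢ proj₂ f

  Adjacent : Edge → Edge → Set
  Adjacent f e = proj₁ f ≡ proj₁ e ⊎ proj₂ f ≡ proj₂ e

  Blocked : List Edge → Edge → Set
  Blocked G e = ∃[ f ] (f ∈ G × Adjacent f e × f ≽ e)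

  clashes : Edge → Edge → Bool
  clashes x e = does (proj₁ e ≟F proj₁ x) ∨ does (proj₂ e ≟F proj₂ x)

  any-clashes-true : ∀ x acc → any (clashes x) acc ≡ true → ∃[ f ] (f ∈ acc × Adjacent f x)
  any-clashes-true x (e ∷ acc) eq with proj₁ e ≟F proj₁ x | proj₂ e ≟F proj₂ x
  ... | yes same-tail | _          = e , here refl , inj₁ same-tail
  ... | no _          | yes same-head = e , here refl , inj₂ same-head
  ... | no _          | no _       with any-clashes-true x acc eq
  ...   | f , f∈ , adj = f , there f∈ , adj

  any-clashes-false : ∀ x acc → any (clashes x) acc ≡ false → All (λ e → Disjoint e x) acc
  any-clashes-false x []        _  = []
  any-clashes-false x (e ∷ acc) eq with proj₁ e ≟F proj₁ x | proj₂ e ≟F proj₂ x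
  ... | no ≢tail | no ≢head = (≢tail , ≢head) ∷ any-clashes-false x acc eq

  record Invariant (acc rest : List Edge) : Set where
    field
      sorted    : AllPairs _≽_ acc
      matching  : AllPairs Disjoint acc
      dominates : All (λ e → All (e ≽_) rest) acc

  invariant-skip : ∀ {acc x rest} → Invariant acc (x ∷ rest) → Invariant acc rest
  invariant-skip inv = record
    { sorted = sorted ; matching = matching ; dominates = All.map All.tail dominates }
    where open Invariant inv

  invariant-add : ∀ {acc x rest} → Invariant acc (x ∷ rest) → All (x ≽_) rest →
                  All (λ e → Disjoint e x) acc → Invariant (acc ++ x ∷ []) rest
  invariant-add inv x≽rest disjoint = record
    { sorted    = AllPairs.++⁺ sorted ([] ∷ []) (All.map (λ d → All.head d ∷ []) dominates)
    ; matching  = AllPairs.++⁺ matching ([] ∷ []) (All.map (_∷ []) disjoint)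
    ; dominates = All.++⁺ (All.map All.tail dominates) (x≽rest ∷ [])
    }
    where open Invariant inv

  initial : ∀ {rest} → Invariant [] rest
  initial = record { sorted = [] ; matching = [] ; dominates = [] }

  foldl-step-⊇ : ∀ acc rest {e} → e ∈ acc → e ∈ foldl step acc rest
  foldl-step-⊇ acc []         e∈ = e∈
  foldl-step-⊇ acc (x ∷ rest) e∈ with any (clashes x) acc
  ... | true  = foldl-step-⊇ acc rest e∈
  ... | false = foldl-step-⊇ (acc ++ x ∷ []) rest (∈-++⁺ˡ e∈)

  -- An edge is skipped only because of an earlier, hence at least as heavy, adjacent edge.
  foldl-step-invariant : ∀ acc rest → Invariant acc rest → AllPairs _≽_ rest →
    Invariant (foldl step acc rest) [] × (∀ e → e ∈ rest → Blocked (foldl step acc rest) e)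
  foldl-step-invariant acc [] inv _ = inv , λ _ ()
  foldl-step-invariant acc (x ∷ rest) inv (x≽rest ∷ sorted-rest) with any (clashes x) acc in eq
  ... | true with foldl-step-invariant acc rest (invariant-skip inv) sorted-rest
  ...   | inv′ , blocked = inv′ , λ where
          e (here refl) → let f , f∈ , adj = any-clashes-true x acc eq in
            f , foldl-step-⊇ acc rest f∈ , adj , All.head (All.lookup (Invariant.dominates inv) f∈)
          e (there e∈) → blocked e e∈
  foldl-step-invariant acc (x ∷ rest) inv (x≽rest ∷ sorted-rest) | false
    with foldl-step-invariant (acc ++ x ∷ []) rest (invariant-add inv x≽rest (any-clashes-false x acc eq)) sorted-rest
  ... | inv′ , blocked = inv′ , λ where
          e (here refl) → x , foldl-step-⊇ (acc ++ x ∷ []) rest (∈-++⁺ʳ acc (here refl)) , inj₁ refl , ≤-refl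
          e (there e∈) → blocked e e∈

  module _ {ord} (valid : ValidOrder ord) where

    mgreedy-invariant : Invariant (mgreedy ord) []
    mgreedy-invariant = proj₁ (foldl-step-invariant [] ord initial (ValidOrder.sorted valid))

    mgreedy-blocks : ∀ e → Blocked (mgreedy ord) e
    mgreedy-blocks e = proj₂ (foldl-step-invariant [] ord initial (ValidOrder.sorted valid)) e
                             (ValidOrder.complete valid e)

  unique-by : ∀ {B : Set} (π : Edge → B) {G e f} → AllPairs (λ e f → π e ≢ π f) G →
              e ∈ G → f ∈ G → π e ≡ π f → e ≡ f
  unique-by π (_ ∷ _)        (here refl) (here refl) _  = refl
  unique-by π (distinct ∷ _) (here refl) (there f∈)  eq = ⊥-elim (All.lookup distinct f∈ eq)
  unique-by π (distinct ∷ _) (there e∈)  (here refl) eq = ⊥-elim (All.lookup distinct e∈ (sym eq))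
  unique-by π (_ ∷ rest)     (there e∈)  (there f∈)  eq = unique-by π rest e∈ f∈ eq

  sorted-lookup : ∀ {G} → AllPairs _≽_ G → ∀ q p → toℕ q ≤ toℕ p → lookup G q ≽ lookup G p
  sorted-lookup (_ ∷ _)      fzero    fzero    _       = ≤-refl
  sorted-lookup (≽rest ∷ _)  fzero    (fsuc p) _       = All.lookup ≽rest (∈-lookup p)
  sorted-lookup (_ ∷ sorted) (fsuc q) (fsuc p) (s≤s le) = sorted-lookup sorted q p le

  addedNoLaterThan⇒≽ : ∀ {G e f} → AllPairs _≽_ G → AddedNoLaterThan G e f → e ≽ f
  addedNoLaterThan⇒≽ sorted (q , p , refl , refl , q≤p) = sorted-lookup sorted q p q≤p

module SmallCycle {A : Set} (_≟_ : DecidableEquality A) {n : ℕ} (S : Fin n → List A)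
  (substring-free : ∀ i j → i ≢ j → ¬ Strings.Substring _≟_ (S i) (S j))
  {ord : List (Fin n × Fin n)} (valid : Strings.Instance.ValidOrder _≟_ S ord)
  {m : ℕ} (c : Fin (suc m) → Fin n)
  (cycle : Strings.Instance.Cycle.IsCycleOf _≟_ S c (Strings.Instance.mgreedy _≟_ S ord))
  (small : 2 * Strings.Instance.Cycle.w _≟_ S c < Strings.Instance.Cycle.o _≟_ S c) where

  open Strings _≟_
  open Instance S
  open Cycle c
  open IsCycleOf cycle
  open Overlaps _≟_
  open Greedy _≟_ S

  -- The cycle read cyclically: σ i is s_(i mod (m+1)), so σ (m + 1) is s_0 and
  -- cycleEdge m is the closing edge; P i is the position of σ i in R.
  index : ℕ → Fin (suc m)
  index i = i mod suc m

  σ : ℕ → List A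
  σ = S ∘ c ∘ index

  cycleEdge : ℕ → Edge
  cycleEdge i = c (index i) , c (index (suc i))

  d : ℕ → ℕ
  d i = dist (σ i) (σ (suc i))

  L : ℕ → ℕ
  L i = ovLen (σ i) (σ (suc i))

  P : ℕ → ℕ
  P = pos d

  toℕ-index : ∀ {i} → i ≤ m → toℕ (index i) ≡ i
  toℕ-index i≤m = trans (toℕ-fromℕ< _) (m<n⇒m%n≡m (s≤s i≤m))

  index-toℕ : ∀ {i} (k : Fin (suc m)) → i ≡ toℕ k → index i ≡ k
  index-toℕ k refl = toℕ-injective (toℕ-index (s≤s⁻¹ (toℕ<n k)))

  index-wrap : index (suc m) ≡ fzero
  index-wrap = toℕ-injective (trans (toℕ-fromℕ< _) (n%n≡0 (suc m)))

  σ-wrap : σ (suc m) ≡ σ 0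
  σ-wrap = cong (S ∘ c) index-wrap

  edge≡cycleEdge : ∀ k → edge k ≡ cycleEdge (toℕ k)
  edge≡cycleEdge k = cong₂ _,_ (cong c (sym (index-toℕ (inject₁ k) (sym (toℕ-inject₁ k)))))
                               (cong c (sym (index-toℕ (fsuc k) refl)))

  closing≡cycleEdge : closing ≡ cycleEdge m
  closing≡cycleEdge = cong₂ _,_ (cong c (sym (index-toℕ (fromℕ m) (sym (toℕ-fromℕ m)))))
                                (cong c (sym index-wrap))

  G : List Edge
  G = mgreedy ord

  cycleEdge∈G : ∀ {i} → i ≤ m → cycleEdge i ∈ G
  cycleEdge∈G {i} i≤m with m≤n⇒m<n∨m≡n i≤m
  ... | inj₁ i<m = subst (_∈ G) (trans (edge≡cycleEdge (fromℕ< i<m)) (cong cycleEdge (toℕ-fromℕ< i<m)))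
                         (edges∈ (fromℕ< i<m))
  ... | inj₂ refl = subst (_∈ G) closing≡cycleEdge closing∈

  o≤L : ∀ {i} → i ≤ m → o ≤ L i
  o≤L {i} i≤m with m≤n⇒m<n∨m≡n i≤m
  ... | inj₁ i<m = subst (λ e → o ≤ ovE e) (trans (edge≡cycleEdge (fromℕ< i<m)) (cong cycleEdge (toℕ-fromℕ< i<m)))
                         (addedNoLaterThan⇒≽ (Invariant.sorted (mgreedy-invariant valid)) (closingLast (fromℕ< i<m)))
  ... | inj₂ refl = ≤-reflexive (cong ovE closing≡cycleEdge)

  substring⇒index≡ : ∀ {i j} → i ≤ m → j ≤ m → Substring (σ i) (σ j) → i ≡ j
  substring⇒index≡ {i} {j} i≤m j≤m sub with c (index i) ≟F c (index j)
  ... | yes same = trans (sym (toℕ-index i≤m)) (trans (cong toℕ (injective _ _ same)) (toℕ-index j≤m))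
  ... | no differ = ⊥-elim (substring-free _ _ differ sub)

  ≡⇒substring : ∀ {s t : List A} → s ≡ t → Substring s t
  ≡⇒substring {s} refl = [] , [] , sym (++-identityʳ s)

  ovLen-to-σ0-≤ : ∀ {k} → k ≤ m → ovLen (σ k) (σ 0) ≤ L k
  ovLen-to-σ0-≤ {k} k≤m with mgreedy-blocks valid (c (index k) , c fzero)
  ... | f , f∈ , inj₁ same-tail , f≽ =
    subst (λ e → ovLen (σ k) (σ 0) ≤ ovE e) (unique-by proj₁ tails-distinct f∈ (cycleEdge∈G k≤m) same-tail) f≽
    where
    tails-distinct : AllPairs (λ e f → proj₁ e ≢ proj₁ f) G
    tails-distinct = AllPairs.map proj₁ (Invariant.matching (mgreedy-invariant valid))
  ... | f , f∈ , inj₂ same-head , f≽ =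
    ≤-trans (subst (λ e → ovLen (σ k) (σ 0) ≤ ovE e) (unique-by proj₂ heads-distinct f∈ closing∈ same-head) f≽)
            (o≤L k≤m)
    where
    heads-distinct : AllPairs (λ e f → proj₂ e ≢ proj₂ f) G
    heads-distinct = AllPairs.map proj₂ (Invariant.matching (mgreedy-invariant valid))

  R≡merge : R ≡ merge σ d m
  R≡merge = trans (cong (concat (tabulate edgePref) ++_) (cong (S ∘ proj₁) closing≡cycleEdge))
                  (concat-tabulate≡merge σ d m edgePref λ k →
                     trans (cong (λ e → pref (S (proj₁ e)) (S (proj₂ e))) (edge≡cycleEdge k)) (pref≡take _ _))
    where
    edgePref : Fin m → List A
    edgePref k = pref (S (proj₁ (edge k))) (S (proj₂ (edge k)))

  w≡P : w ≡ P (suc m)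
  w≡P = trans (cong₂ _+_ (sum-tabulate≡pos d m _ λ k → cong edgeDist (edge≡cycleEdge k))
                         (cong edgeDist closing≡cycleEdge))
              (sym (pos-suc d m))
    where
    edgeDist : Edge → ℕ
    edgeDist e = dist (S (proj₁ e)) (S (proj₂ e))

  chained : Chained σ d
  chained j = subst (d j ≤_) (dist+ovLen (σ j) (σ (suc j))) (m≤m+n (d j) (L j)) , occursAt-ov (σ j) (σ (suc j))

  σ-occursAt-R : ∀ {i} → i ≤ m → OccursAt (σ i) (P i) R
  σ-occursAt-R {i} i≤m = subst (OccursAt (σ i) (P i)) (sym R≡merge) (merge-occursAt chained m i i≤m)

  length-R : length R ≡ w + L m
  length-R = begin
    length R               ≡⟨ cong length R≡merge ⟩
    length (merge σ d m)   ≡⟨ length-merge chained m ⟩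
    P m + length (σ m)     ≡⟨ cong (P m +_) (dist+ovLen (σ m) (σ (suc m))) ⟨
    P m + (d m + L m)      ≡⟨ +-assoc (P m) (d m) (L m) ⟨
    P m + d m + L m        ≡⟨ cong (_+ L m) (trans (sym (pos-suc d m)) (sym w≡P)) ⟩
    w + L m                ∎
    where open ≡-Reasoning

  w+w<σ : ∀ {i} → i ≤ m → w + w < length (σ i)
  w+w<σ {i} i≤m = <-≤-trans (subst (_< o) (cong (w +_) (+-identityʳ w)) small)
                            (≤-trans (o≤L i≤m) (ovLen-≤ (σ i) (σ (suc i))))

  P≤w : ∀ {i} → i ≤ m → P i ≤ w
  P≤w {i} i≤m = subst (P i ≤_) (sym w≡P) (pos-mono d (m≤n⇒m≤1+n i≤m))

  w≤σ : ∀ {i} → i ≤ m → w ≤ length (σ i)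
  w≤σ i≤m = ≤-trans (m≤m+n _ _) (<⇒≤ (w+w<σ i≤m))

  0<w : 0 < w
  0<w = subst (0 <_) (sym (trans w≡P (pos-suc d m)))
          (<-≤-trans (dist-positive (σ m) (σ (suc m)) (≤-<-trans z≤n (w+w<σ ≤-refl)) last≡first)
                     (m≤n+m (d m) (P m)))
    where
    last≡first : Substring (σ m) (σ (suc m)) → σ m ≡ σ (suc m)
    last≡first sub with substring⇒index≡ ≤-refl z≤n (subst (Substring (σ m)) σ-wrap sub)
    ... | refl = sym σ-wrap

  R-isPeriod-w : IsPeriod R w
  R-isPeriod-w = occursAt-twice⇒isPeriod ov-closing-at-w ov-closing-at-0
                   (≤-reflexive (trans length-R (cong (w +_) (sym |ov-closing|))))
    where
    ov-closing : List A
    ov-closing = drop (d m) (σ m)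
    |ov-closing| : length ov-closing ≡ L m
    |ov-closing| = trans (length-drop (d m) (σ m))
                         (trans (cong (_∸ d m) (sym (dist+ovLen (σ m) (σ (suc m))))) (m+n∸m≡n (d m) (L m)))
    ov-closing-at-w : OccursAt ov-closing w R
    ov-closing-at-w = subst (λ b → OccursAt ov-closing b R) (trans (sym (pos-suc d m)) (sym w≡P))
                        (occursAt-trans (occursAt-drop (d m) (σ m)) (σ-occursAt-R ≤-refl))
    ov-closing-at-0 : OccursAt ov-closing 0 R
    ov-closing-at-0 = occursAt-trans (subst (OccursAt ov-closing 0) σ-wrap (occursAt-ov (σ m) (σ (suc m))))
                                     (σ-occursAt-R z≤n)

  no-period-between : ∀ {p k} → 0 < p → k ≤ m → P k ≤ p → p < P (suc k) → ¬ IsPeriod R p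
  no-period-between {p} {k} 0<p k≤m Pk≤p p<Pk+1 perR =
    [ no-prefix , no-infix ]′ (continues⇒occursAt (σ k) g (σ 0)
      (isPeriod⇒continues perR (σ-occursAt-R k≤m) (σ-occursAt-R z≤n) Pk+g≡p))
    where
    g : ℕ
    g = p ∸ P k
    Pk+g≡p : P k + g ≡ p
    Pk+g≡p = m+[n∸m]≡n Pk≤p
    g<d : g < d k
    g<d = +-cancelˡ-< (P k) g (d k) (subst₂ _<_ (sym Pk+g≡p) (pos-suc d k) p<Pk+1)
    d≤σ : d k ≤ length (σ k)
    d≤σ = proj₁ (chained k)
    k≡0⇒0<g : 0 ≡ k → 0 < g
    k≡0⇒0<g refl = 0<p
    no-infix : ¬ OccursAt (σ 0) g (σ k)
    no-infix occ with substring⇒index≡ z≤n k≤m (occursAt⇒infix occ)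
    ... | refl = <⇒≱ (m<n+m (length (σ 0)) 0<p) (occursAt-≤ occ (≤-<-trans z≤n (w+w<σ z≤n)) ≤-refl)
    no-prefix : ¬ OccursAt (drop g (σ k)) 0 (σ 0)
    no-prefix occ = <⇒≱ (<-≤-trans L<σ∸g σ∸g≤ovLen) (ovLen-to-σ0-≤ k≤m)
      where
      σ∸g≤ovLen : length (σ k) ∸ g ≤ ovLen (σ k) (σ 0)
      σ∸g≤ovLen = ovLen-≥ (σ k) (σ 0) g (<⇒≤ (<-≤-trans g<d d≤σ))
                    (λ same → k≡0⇒0<g (sym (substring⇒index≡ k≤m z≤n (≡⇒substring same)))) occ
      L<σ∸g : L k < length (σ k) ∸ g
      L<σ∸g = subst (_< length (σ k) ∸ g)
                (trans (cong (_∸ d k) (sym (dist+ovLen (σ k) (σ (suc k))))) (m+n∸m≡n (d k) (L k)))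
                (∸-monoʳ-< g<d d≤σ)

  R-no-shorter-period : ∀ p → 0 < p → p < w → ¬ IsPeriod R p
  R-no-shorter-period p 0<p p<w with pos-locate d (suc m) (subst (p <_) w≡P p<w)
  ... | k , k<1+m , Pk≤p , p<Pk+1 = no-period-between 0<p (s≤s⁻¹ k<1+m) Pk≤p p<Pk+1

  σ-no-shorter-period : ∀ {i} → i ≤ m → ∀ p → 0 < p → p < w → ¬ IsPeriod (σ i) p
  σ-no-shorter-period {i} i≤m p 0<p p<w perσ = R-no-shorter-period p 0<p p<w
    (isPeriod-spread R-isPeriod-w (σ-occursAt-R i≤m) (P≤w i≤m) p<w
       (<⇒≤ (≤-<-trans (+-monoˡ-≤ w (<⇒≤ p<w)) (w+w<σ i≤m))) perσ)

  R-period : period R ≡ w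
  R-period = dist-self-≡-least-period R w 0<w (subst (w ≤_) (sym length-R) (m≤m+n w (L m)))
               R-isPeriod-w R-no-shorter-period

  σ-period : ∀ {i} → i ≤ m → period (σ i) ≡ w
  σ-period i≤m = dist-self-≡-least-period _ w 0<w (w≤σ i≤m)
                   (isPeriod-occursAt R-isPeriod-w (σ-occursAt-R i≤m)) (σ-no-shorter-period i≤m)

  σ-equivalent-R : ∀ {i} → i ≤ m → Equivalent (σ i) R
  σ-equivalent-R {i} i≤m = drop (P i) u , take (P i) u ,
    trans (pref≡take (σ i) (σ i)) (trans (cong (λ k → take k (σ i)) (σ-period i≤m))
      (take-isPeriod-rotation R-isPeriod-w (σ-occursAt-R i≤m) (P≤w i≤m) (w≤σ i≤m))) ,
    trans (pref≡take R R) (trans (cong (λ k → take k R) R-period) (sym (take++drop≡id (P i) u)))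
    where
    u : List A
    u = take w R

lemma7 : {A : Set} (_≟_ : DecidableEquality A) (n : ℕ) (S : Fin n → List A) →
    (∀ i → S i ≢ []) →
    (∀ i j → i ≢ j → ¬ Strings.Substring _≟_ (S i) (S j)) →
    (ord : List (Fin n × Fin n)) → Strings.Instance.ValidOrder _≟_ S ord →
    (m : ℕ) (c : Fin (suc m) → Fin n) →
    Strings.Instance.Cycle.IsCycleOf _≟_ S c (Strings.Instance.mgreedy _≟_ S ord) →
    2 * Strings.Instance.Cycle.w _≟_ S c < Strings.Instance.Cycle.o _≟_ S c →
    ∀ k → Strings.Equivalent _≟_ (S (c k)) (Strings.Instance.Cycle.R _≟_ S c)
        × Strings.period _≟_ (S (c k)) ≡ Strings.Instance.Cycle.w _≟_ S c
lemma7 _≟_ n S _ substring-free ord valid m c cycle small k =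
  subst (λ s → Equivalent s R × period s ≡ w) (cong (S ∘ c) (index-toℕ k refl))
        (σ-equivalent-R k≤m , σ-period k≤m)
  where
  open Strings _≟_
  open Strings.Instance.Cycle _≟_ S c using (R; w)
  open SmallCycle _≟_ S substring-free valid c cycle small
  k≤m : toℕ k ≤ m
  k≤m = s≤s⁻¹ (toℕ<n k)
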